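{- Let $r$ be a positive integer, let $p_1,\dots,p_r$ be distinct primes, let $e_1,\dots,e_r$ be positive integers, and let $m=\prod_{i=1}^r p_i^{e_i}$. Then almost every non-symmetric Boolean function $f:\{0,1\}^n\to\{0,1\}$ satisfies $$m\cdot d_{p_1^{e_1}}(f)\cdots d_{p_r^{e_r}}(f)>\lg n-1,$$ i.e. the fraction of non-symmetric $f:\{0,1\}^n\to\{0,1\}$ satisfying this inequality tends to $1$ as $n\to\infty$.
   Context: $\lg$ denotes logarithm base $2$. $f$ is symmetric if $f(x)$ depends only on $\sum_i x_i$. For an integer $q\ge 2$, $d_q(f)$ denotes the total degree of the unique multilinear polynomial $P\in\mathbb{Z}_q[x_1,\dots,x_n]$ with $P(x)\equiv f(x)\pmod q$ for all $x\in\{0,1\}^n$, where $\mathbb{Z}_q$ is the ring of integers modulo $q$. -}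

module Defs where

open import Data.Nat using (ℕ; zero; suc; _+_; _*_; _⊔_; _≟_)
open import Data.Bool using (Bool; true; false; if_then_else_)
open import Data.Fin using (Fin; toℕ)
import Data.Fin as F
open import Data.Vec using (Vec; []; _∷_)
open import Data.List using (List; []; _∷_; _++_; map; concatMap; foldr)
open import Data.Product using (∃; ∃-syntax; _×_; _,_)
open import Relation.Binary.PropositionalEquality using (_≡_)
open import Relation.Nullary using (¬_; yes; no)

BoolFun : ℕ → Set
BoolFun n = Vec Bool n → Bool

inputs : (n : ℕ) → List (Vec Bool n)
inputs zero = [] ∷ []
inputs (suc n) = map (false ∷_) (inputs n) ++ map (true ∷_) (inputs n)

-- all 2^(2^n) Boolean functions on n variables, each (extensionally) exactly once
allFuns : (n : ℕ) → List (BoolFun n)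
allFuns zero = (λ _ → false) ∷ (λ _ → true) ∷ []
allFuns (suc n) =
  concatMap (λ g → map (λ h → λ { (b ∷ x) → if b then g x else h x }) (allFuns n)) (allFuns n)

b2n : Bool → ℕ
b2n true = 1
b2n false = 0

weight : {n : ℕ} → Vec Bool n → ℕ
weight [] = 0
weight (b ∷ x) = b2n b + weight x

Symmetric : {n : ℕ} → BoolFun n → Set
Symmetric f = ∀ x y → weight x ≡ weight y → f x ≡ f y

_≡_[mod_] : ℕ → ℕ → ℕ → Set
a ≡ b [mod q ] = ∃[ k ] ∃[ l ] (a + k * q ≡ b + l * q)

-- a multilinear polynomial over Z_q in x_1..x_n: coefficient c S of the monomial
-- prod_{i in S} x_i, where S ⊆ [n] is given by its indicator vector
MLPoly : ℕ → ℕ → Set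
MLPoly q n = Vec Bool n → Fin q

monomial : {n : ℕ} → Vec Bool n → Vec Bool n → ℕ
monomial [] [] = 1
monomial (s ∷ S) (b ∷ x) = (if s then b2n b else 1) * monomial S x

-- P(x) = sum_S c_S prod_{i in S} x_i  (representative in ℕ, to be read mod q)
evalPoly : {q n : ℕ} → MLPoly q n → Vec Bool n → ℕ
evalPoly {n = n} c x = foldr (λ S acc → toℕ (c S) * monomial S x + acc) 0 (inputs n)

totalDegree : {q n : ℕ} → MLPoly q n → ℕ
totalDegree {n = n} c = foldr step 0 (inputs n)
  where
  step : Vec Bool n → ℕ → ℕ
  step S acc with toℕ (c S) ≟ 0
  ... | yes _ = acc
  ... | no _ = weight S ⊔ acc

Represents : {q n : ℕ} → MLPoly q n → BoolFun n → Set
Represents {q} {n} c f = ∀ x → evalPoly c x ≡ b2n (f x) [mod q ]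

-- d_q(f) = d : d is the total degree of the (unique) multilinear P over Z_q representing f
HasDeg : (q : ℕ) {n : ℕ} → BoolFun n → ℕ → Set
HasDeg q {n} f d = ∃[ c ] (Represents {q} {n} c f × totalDegree c ≡ d)

prodFin : (r : ℕ) → (Fin r → ℕ) → ℕ
prodFin zero g = 1
prodFin (suc r) g = g F.zero * prodFin r (λ i → g (F.suc i))

data Count {A : Set} (P : A → Set) : List A → ℕ → Set where
  c-nil : Count P [] 0
  c-yes : ∀ {x xs k} → P x → Count P xs k → Count P (x ∷ xs) (suc k)
  c-no  : ∀ {x xs k} → ¬ P x → Count P xs k → Count P (x ∷ xs) k

-- A non-symmetric f has d_q(f) ≥ 1 for every q ≥ 2, because a representation of degree 0
-- is constant.  Hence if m · d_{q₁}(f) ⋯ d_{q_r}(f) ≤ lg n − 1, then already d_{q₁}(f) ≤ L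
-- for L = ⌊lg (n + 1)⌋.  A function of degree at most L modulo q is determined by the
-- coefficients of the at most (n + 1)^L monomials of weight at most L, so there are at most
-- q^((n+1)^L) ≤ 2^(2^O(lg² n)) such functions, against at least 2^(2^n) − 2^(n+1)
-- non-symmetric ones.
module Submission where

open import Defs
open import Data.Nat
  using (ℕ; zero; suc; _+_; _*_; _∸_; _^_; _≤_; _<_; z≤n; s≤s; s≤s⁻¹; _≤?_; _<?_; NonZero; >-nonZero; nonTrivial⇒n>1)
open import Data.Nat.Properties
open import Data.Nat.DivMod using (_%_; [m+kn]%n≡m%n; m<n⇒m%n≡m)
open import Data.Nat.Primality using (Prime; prime⇒nonZero; prime⇒nonTrivial)
open import Data.Nat.Tactic.RingSolver using (solve-∀)
open import Data.Bool using (Bool; true; false)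
open import Data.Fin using (Fin; toℕ)
import Data.Fin as Fin
open import Data.Fin.Properties using (toℕ-injective)
open import Data.Vec using (Vec; []; _∷_)
open import Data.List using (List; []; _∷_; _++_; map; concatMap; foldr; length; upTo; allFin)
open import Data.List.Properties
  using (length-map; length-++; length-upTo; length-tabulate; length-removeAt′; ∷-injectiveˡ; ∷-injectiveʳ)
open import Data.List.Membership.Propositional using (_∈_)
open import Data.List.Membership.Propositional.Properties
  using (∈-map⁺; ∈-++⁺ˡ; ∈-++⁺ʳ; ∈-concat⁺′; ∈-upTo⁺; ∈-allFin)
open import Data.List.Relation.Unary.Any using (here; there; _─_; index)
open import Data.List.Relation.Unary.All using (All; []; _∷_)
import Data.List.Relation.Unary.All as All
import Data.List.Relation.Unary.All.Properties as All
open import Data.List.Relation.Unary.AllPairs using (AllPairs; []; _∷_)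
import Data.List.Relation.Unary.AllPairs as AllPairs
import Data.List.Relation.Unary.AllPairs.Properties as AllPairs
open import Data.List.Relation.Binary.Sublist.Propositional using (_⊆_; []; _∷_; _∷ʳ_)
open import Data.List.Relation.Binary.Sublist.Propositional.Properties using (All-resp-⊆)
open import Data.Product using (∃-syntax; _×_; _,_; proj₁)
open import Data.Sum using (inj₁; inj₂)
open import Effect.Monad using (RawMonad)
open import Function using (_∘_)
open import Level using (0ℓ)
open import Relation.Nullary using (¬_; yes; no; contradiction)
open import Relation.Nullary.Negation using (¬¬-Monad; ¬¬-map)
open import Relation.Nullary.Decidable using (decidable-stable)
open import Relation.Binary.PropositionalEquality

AllPairs-resp-⊆ : ∀ {A : Set} {R : A → A → Set} {xs ys} → ys ⊆ xs → AllPairs R xs → AllPairs R ys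
AllPairs-resp-⊆ []         []         = []
AllPairs-resp-⊆ (_ ∷ʳ τ)   (_ ∷ ps)   = AllPairs-resp-⊆ τ ps
AllPairs-resp-⊆ (refl ∷ τ) (px ∷ ps)  = All-resp-⊆ τ px ∷ AllPairs-resp-⊆ τ ps

Count⇒complement : ∀ {A : Set} {P : A → Set} {xs a} → Count P xs a →
  ∃[ zs ] (zs ⊆ xs × All (¬_ ∘ P) zs × a + length zs ≡ length xs)
Count⇒complement c-nil = [] , [] , [] , refl
Count⇒complement (c-yes _ count) with zs , τ , ¬Pzs , eq ← Count⇒complement count =
  zs , _ ∷ʳ τ , ¬Pzs , cong suc eq
Count⇒complement {a = a} (c-no ¬Px count) with zs , τ , ¬Pzs , eq ← Count⇒complement count =
  _ , refl ∷ τ , ¬Px ∷ ¬Pzs , trans (+-suc a (length zs)) (cong suc eq)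

Count-difference : ∀ {A : Set} {P Q : A → Set} {xs a b} → Count P xs a → Count (λ x → P x × Q x) xs b →
  ∃[ ys ] (ys ⊆ xs × All (λ x → P x × ¬ Q x) ys × a ≤ b + length ys)
Count-difference c-nil c-nil = [] , [] , [] , z≤n
Count-difference (c-yes _ countP) (c-yes _ countPQ) with ys , τ , ys-ok , a≤ ← Count-difference countP countPQ =
  ys , _ ∷ʳ τ , ys-ok , s≤s a≤
Count-difference {b = b} (c-yes Px countP) (c-no ¬PQx countPQ)
  with ys , τ , ys-ok , a≤ ← Count-difference countP countPQ =
  _ , refl ∷ τ , (Px , λ Qx → ¬PQx (Px , Qx)) ∷ ys-ok , ≤-trans (s≤s a≤) (≤-reflexive (sym (+-suc b (length ys))))
Count-difference (c-no ¬Px _) (c-yes (Px , _) _) = contradiction Px ¬Px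
Count-difference (c-no _ countP) (c-no _ countPQ) with ys , τ , ys-ok , a≤ ← Count-difference countP countPQ =
  ys , _ ∷ʳ τ , ys-ok , a≤

∈-─⁺ : ∀ {B : Set} {b b' : B} {M : List B} (b∈M : b ∈ M) → b' ∈ M → b' ≢ b → b' ∈ (M ─ b∈M)
∈-─⁺ (here refl)  (here refl)  b'≢b = contradiction refl b'≢b
∈-─⁺ (here refl)  (there b'∈M) _    = b'∈M
∈-─⁺ (there b∈M)  (here refl)  _    = here refl
∈-─⁺ (there b∈M)  (there b'∈M) b'≢b = there (∈-─⁺ b∈M b'∈M b'≢b)

HasCodeIn : ∀ {A B : Set} → (A → B → Set) → List B → A → Set
HasCodeIn Code M x = ∃[ b ] (b ∈ M × Code x b)

module _ {A B : Set} (Apart : A → A → Set) (Code : A → B → Set)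
         (codes-separate : ∀ {x y b} → Code x b → Code y b → ¬ Apart x y) where

  length≤-by-codes : ∀ {xs} (M : List B) → AllPairs Apart xs → All (HasCodeIn Code M) xs → length xs ≤ length M
  length≤-by-codes M [] [] = z≤n
  length≤-by-codes {x ∷ xs} M (x#xs ∷ #xs) ((b , b∈M , code) ∷ codes) = begin
    suc (length xs)        ≤⟨ s≤s (length≤-by-codes (M ─ b∈M) #xs (All.zipWith shrink (x#xs , codes))) ⟩
    suc (length (M ─ b∈M)) ≡⟨ length-removeAt′ M (index b∈M) ⟨
    length M               ∎
    where
    open ≤-Reasoning
    shrink : ∀ {y} → Apart x y × HasCodeIn Code M y → HasCodeIn Code (M ─ b∈M) y
    shrink (x#y , b' , b'∈M , code') = b' , ∈-─⁺ b∈M b'∈M (λ { refl → codes-separate code code' x#y }) , code'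

  ¬¬-codes⇒length≤ : ∀ {xs} (M : List B) → AllPairs Apart xs → All (¬_ ∘ ¬_ ∘ HasCodeIn Code M) xs → length xs ≤ length M
  ¬¬-codes⇒length≤ M #xs ¬¬codes = decidable-stable (_ ≤? _)
    (¬¬-map (length≤-by-codes M #xs) (All.sequenceA 0ℓ (RawMonad.rawApplicative ¬¬-Monad) ¬¬codes))

words : {B : Set} → List B → ℕ → List (List B)
words E zero    = [] ∷ []
words E (suc s) = concatMap (λ a → map (a ∷_) (words E s)) E

length-concatMap-const : ∀ {B C : Set} (g : B → List C) {k} → (∀ a → length (g a) ≡ k) →
  ∀ E → length (concatMap g E) ≡ length E * k
length-concatMap-const g len-g []      = refl
length-concatMap-const g len-g (a ∷ E) =
  trans (length-++ (g a)) (cong₂ _+_ (len-g a) (length-concatMap-const g len-g E))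

length-words : ∀ {B : Set} (E : List B) s → length (words E s) ≡ length E ^ s
length-words E zero    = refl
length-words E (suc s) =
  length-concatMap-const _ (λ a → trans (length-map (a ∷_) (words E s)) (length-words E s)) E

∈-words : ∀ {B : Set} {E : List B} {w} → All (_∈ E) w → w ∈ words E (length w)
∈-words []           = here refl
∈-words (a∈E ∷ w∈E*) = ∈-concat⁺′ (∈-map⁺ (_ ∷_) (∈-words w∈E*)) (∈-map⁺ _ a∈E)

map-≡⇒≡-on-∈ : ∀ {A B : Set} {u v : A → B} {xs x} → map u xs ≡ map v xs → x ∈ xs → u x ≡ v x
map-≡⇒≡-on-∈ {xs = _ ∷ _} eq (here refl)  = ∷-injectiveˡ eq
map-≡⇒≡-on-∈ {xs = _ ∷ _} eq (there x∈xs) = map-≡⇒≡-on-∈ (∷-injectiveʳ eq) x∈xs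

1+2^m≤2^[1+m] : ∀ m → 1 + 2 ^ m ≤ 2 ^ suc m
1+2^m≤2^[1+m] m = ≤-trans (≤-reflexive (+-comm 1 (2 ^ m)))
  (+-monoʳ-≤ (2 ^ m) (≤-trans (m^n>0 2 m) (≤-reflexive (sym (+-identityʳ (2 ^ m))))))

+-≤-2^ : ∀ k Y → k + 2 ^ Y ≤ 2 ^ (k + Y)
+-≤-2^ zero    Y = ≤-refl
+-≤-2^ (suc k) Y = ≤-trans (s≤s (+-≤-2^ k Y)) (1+2^m≤2^[1+m] (k + Y))

m≤2^m : ∀ m → m ≤ 2 ^ m
m≤2^m m = ≤-trans (m≤m+n m 1) (≤-trans (+-≤-2^ m 0) (≤-reflexive (cong (2 ^_) (+-identityʳ m))))

2^m<2^n⇒m<n : ∀ {m n} → 2 ^ m < 2 ^ n → m < n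
2^m<2^n⇒m<n {m} {n} 2^m<2^n with m <? n
... | yes m<n = m<n
... | no  m≮n = contradiction (^-monoʳ-≤ 2 (≮⇒≥ m≮n)) (<⇒≱ 2^m<2^n)

floorLog₂ : ∀ n → ∃[ L ] (2 ^ L ≤ suc n × suc n < 2 ^ suc L)
floorLog₂ zero = 0 , s≤s z≤n , s≤s (s≤s z≤n)
floorLog₂ (suc n) with L , lower , upper ← floorLog₂ n with m≤n⇒m<n∨m≡n upper
... | inj₁ 2+n<2^[1+L] = L , m≤n⇒m≤1+n lower , 2+n<2^[1+L]
... | inj₂ 2+n≡2^[1+L] = suc L , ≤-reflexive (sym 2+n≡2^[1+L]) ,
  subst (_< 2 ^ suc (suc L)) (sym 2+n≡2^[1+L]) (^-monoʳ-< 2 (s≤s (s≤s z≤n)) (n<1+n (suc L)))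

square-≤-2^ : ∀ L → 6 ≤ L → suc (suc L * suc L) ≤ 2 ^ L
square-≤-2^ _ 6≤L with t , refl ← m≤n⇒∃[o]m+o≡n 6≤L = go t
  where
  expand : ∀ L → suc (suc (suc L) * suc (suc L)) ≡ suc (suc L * suc L) + (1 + (2 * L + 2))
  expand = solve-∀
  square : ∀ L → suc (suc L * suc L) ≡ L * L + (2 * L + 2)
  square = solve-∀
  go : ∀ t → suc (suc (6 + t) * suc (6 + t)) ≤ 2 ^ (6 + t)
  go zero    = m≤m+n 50 14
  go (suc t) = begin
    suc (suc (suc L) * suc (suc L))           ≡⟨ expand L ⟩
    suc (suc L * suc L) + (1 + (2 * L + 2))   ≤⟨ +-monoʳ-≤ (suc (suc L * suc L)) step≤square ⟩
    suc (suc L * suc L) + suc (suc L * suc L) ≤⟨ +-mono-≤ (go t) (≤-trans (go t) (≤-reflexive (sym (+-identityʳ (2 ^ L))))) ⟩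
    2 ^ suc L                                 ∎
    where
    open ≤-Reasoning
    L = 6 + t
    step≤square : 1 + (2 * L + 2) ≤ suc (suc L * suc L)
    step≤square = ≤-trans (+-monoˡ-≤ (2 * L + 2) (*-mono-≤ {1} {L} {1} {L} (s≤s z≤n) (s≤s z≤n)))
                          (≤-reflexive (sym (square L)))

k*q^s≤2^2^[k+q+X] : ∀ k q s X → s ≤ 2 ^ X → k * q ^ s ≤ 2 ^ 2 ^ (k + (q + X))
k*q^s≤2^2^[k+q+X] k q s X s≤2^X = begin
  k * q ^ s                    ≤⟨ *-mono-≤ (m≤2^m k) (^-monoˡ-≤ s (m≤2^m q)) ⟩
  2 ^ k * (2 ^ q) ^ s          ≡⟨ cong (2 ^ k *_) (^-*-assoc 2 q s) ⟩
  2 ^ k * 2 ^ (q * s)          ≡⟨ ^-distribˡ-+-* 2 k (q * s) ⟨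
  2 ^ (k + q * s)              ≤⟨ ^-monoʳ-≤ 2 (+-monoʳ-≤ k (*-mono-≤ (m≤2^m q) s≤2^X)) ⟩
  2 ^ (k + 2 ^ q * 2 ^ X)      ≡⟨ cong (λ e → 2 ^ (k + e)) (^-distribˡ-+-* 2 q X) ⟨
  2 ^ (k + 2 ^ (q + X))        ≤⟨ ^-monoʳ-≤ 2 (+-≤-2^ k (q + X)) ⟩
  2 ^ 2 ^ (k + (q + X))        ∎
  where open ≤-Reasoning

2^2^Z+2^[1+n]≤2^2^n : ∀ Z n → 2 ≤ Z → Z < n → 2 ^ 2 ^ Z + 2 ^ suc n ≤ 2 ^ 2 ^ n
2^2^Z+2^[1+n]≤2^2^n Z (suc n) 2≤Z (s≤s Z≤n) = begin
  2 ^ 2 ^ Z + 2 ^ suc (suc n) ≤⟨ +-mono-≤ (^-monoʳ-≤ 2 (^-monoʳ-≤ 2 Z≤n)) (^-monoʳ-≤ 2 2+n≤2^n) ⟩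
  2 ^ W + 2 ^ W               ≡⟨ cong (2 ^ W +_) (+-identityʳ (2 ^ W)) ⟨
  2 ^ suc W                   ≤⟨ ^-monoʳ-≤ 2 (+-monoˡ-≤ W (m^n>0 2 n)) ⟩
  2 ^ (W + W)                 ≡⟨ cong (λ e → 2 ^ (W + e)) (+-identityʳ W) ⟨
  2 ^ 2 ^ suc n               ∎
  where
  open ≤-Reasoning
  W = 2 ^ n
  2+n≤2^n : 2 + n ≤ 2 ^ n
  2+n≤2^n with t , refl ← m≤n⇒∃[o]m+o≡n (≤-trans 2≤Z Z≤n) =
    ≤-trans (≤-reflexive (+-comm 4 t)) (≤-trans (+-≤-2^ t 2) (≤-reflexive (cong (2 ^_) (+-comm t 2))))

counting-inequality : ∀ k q n L s → 2 ≤ q → k + q + 6 ≤ L → 2 ^ L ≤ suc n → suc n < 2 ^ suc L →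
  s ≤ suc n ^ L → k * q ^ s + 2 ^ suc n ≤ 2 ^ 2 ^ n
counting-inequality k q n L s q≥2 k+q+6≤L 2^L≤1+n 1+n<2^[1+L] s≤[1+n]^L =
  ≤-trans (+-monoˡ-≤ (2 ^ suc n) (k*q^s≤2^2^[k+q+X] k q s X s≤2^X)) (2^2^Z+2^[1+n]≤2^2^n Z n 2≤Z Z<n)
  where
  open ≤-Reasoning
  X = suc L * L
  Z = k + (q + X)
  s≤2^X : s ≤ 2 ^ X
  s≤2^X = begin
    s                ≤⟨ s≤[1+n]^L ⟩
    suc n ^ L        ≤⟨ ^-monoˡ-≤ L (<⇒≤ 1+n<2^[1+L]) ⟩
    (2 ^ suc L) ^ L  ≡⟨ ^-*-assoc 2 (suc L) L ⟩
    2 ^ X            ∎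
  2≤Z : 2 ≤ Z
  2≤Z = ≤-trans q≥2 (≤-trans (m≤m+n q X) (m≤n+m (q + X) k))
  square : ∀ L → suc (L + suc L * L) ≡ suc L * suc L
  square = solve-∀
  Z<n : Z < n
  Z<n = begin-strict
    k + (q + X)    ≡⟨ +-assoc k q X ⟨
    k + q + X      ≤⟨ +-monoˡ-≤ X (≤-trans (m≤m+n (k + q) 6) k+q+6≤L) ⟩
    L + X          <⟨ ≤-reflexive (square L) ⟩
    suc L * suc L  ≤⟨ s≤s⁻¹ (≤-trans (square-≤-2^ L (≤-trans (m≤n+m 6 (k + q)) k+q+6≤L)) 2^L≤1+n) ⟩
    n              ∎

-- The step function of the fold defining totalDegree lives in a where block;
-- unification recovers it, and it then computes like the original.
degreeStep : ∀ {q n} → MLPoly q n → Vec Bool n → ℕ → ℕ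
degreeStep {n = n} c = proj₁ {B = λ g → totalDegree c ≡ foldr g 0 (inputs n)} (_ , refl)

degreeStep-inflationary : ∀ {q n} (c : MLPoly q n) S acc → acc ≤ degreeStep c S acc
degreeStep-inflationary c S acc with toℕ (c S) ≟ 0
... | yes _ = ≤-refl
... | no _  = m≤n⊔m (weight S) acc

degreeStep-≥weight : ∀ {q n} (c : MLPoly q n) S acc → toℕ (c S) ≢ 0 → weight S ≤ degreeStep c S acc
degreeStep-≥weight c S acc c[S]≢0 with toℕ (c S) ≟ 0
... | yes c[S]≡0 = contradiction c[S]≡0 c[S]≢0
... | no _       = m≤m⊔n (weight S) acc

foldr-inflationary-≥ : ∀ {A : Set} (g : A → ℕ → ℕ) (w : A → ℕ) {P : A → Set} →
  (∀ x acc → acc ≤ g x acc) → (∀ x acc → P x → w x ≤ g x acc) →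
  ∀ {x xs} → x ∈ xs → P x → w x ≤ foldr g 0 xs
foldr-inflationary-≥ g w infl dom {xs = y ∷ ys} (here refl) px = dom y _ px
foldr-inflationary-≥ g w infl dom {xs = y ∷ ys} (there x∈ys) px =
  ≤-trans (foldr-inflationary-≥ g w infl dom x∈ys px) (infl y _)

weight≤totalDegree : ∀ {q n} (c : MLPoly q n) {S} → S ∈ inputs n → toℕ (c S) ≢ 0 → weight S ≤ totalDegree c
weight≤totalDegree c = foldr-inflationary-≥ (degreeStep c) weight (degreeStep-inflationary c) (degreeStep-≥weight c)

foldr-+-cong : ∀ {A : Set} (u v : A → ℕ) {xs : List A} → (∀ {x} → x ∈ xs → u x ≡ v x) →
  foldr (λ x acc → u x + acc) 0 xs ≡ foldr (λ x acc → v x + acc) 0 xs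
foldr-+-cong u v {[]} eq = refl
foldr-+-cong u v {x ∷ xs} eq = cong₂ _+_ (eq (here refl)) (foldr-+-cong u v (eq ∘ there))

evalPoly-termwise : ∀ {q n} (c c' : MLPoly q n) x y →
  (∀ {S} → S ∈ inputs n → toℕ (c S) * monomial S x ≡ toℕ (c' S) * monomial S y) →
  evalPoly c x ≡ evalPoly c' y
evalPoly-termwise c c' x y = foldr-+-cong (λ S → toℕ (c S) * monomial S x) (λ S → toℕ (c' S) * monomial S y)

monomial-weight0 : ∀ {n} (S x : Vec Bool n) → weight S ≡ 0 → monomial S x ≡ 1
monomial-weight0 [] [] _ = refl
monomial-weight0 (false ∷ S) (_ ∷ x) w≡0 = trans (+-identityʳ (monomial S x)) (monomial-weight0 S x w≡0)

totalDegree≡0⇒evalPoly-constant : ∀ {q n} (c : MLPoly q n) → totalDegree c ≡ 0 → ∀ x y → evalPoly c x ≡ evalPoly c y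
totalDegree≡0⇒evalPoly-constant c deg≡0 x y = evalPoly-termwise c c x y term
  where
  term : ∀ {S} → S ∈ _ → toℕ (c S) * monomial S x ≡ toℕ (c S) * monomial S y
  term {S} S∈ with toℕ (c S) ≟ 0
  ... | yes c[S]≡0 rewrite c[S]≡0 = refl
  ... | no c[S]≢0 = cong (toℕ (c S) *_) (trans (monomial-weight0 S x w≡0) (sym (monomial-weight0 S y w≡0)))
    where
    w≡0 : weight S ≡ 0
    w≡0 = n≤0⇒n≡0 (subst (weight S ≤_) deg≡0 (weight≤totalDegree c S∈ c[S]≢0))

evalPoly-cong : ∀ {q n} {c c' : MLPoly q n} → (∀ {S} → S ∈ inputs n → c S ≡ c' S) → ∀ x → evalPoly c x ≡ evalPoly c' x
evalPoly-cong {c = c} {c'} c≡c' x = evalPoly-termwise c c' x x (λ {S} S∈ → cong (λ a → toℕ a * monomial S x) (c≡c' S∈))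

≡[mod]⇒%≡ : ∀ {a b q} .{{_ : NonZero q}} → a ≡ b [mod q ] → a % q ≡ b % q
≡[mod]⇒%≡ {a} {b} {q} (k , l , eq) = begin
  a % q           ≡⟨ [m+kn]%n≡m%n a k q ⟨
  (a + k * q) % q ≡⟨ cong (_% q) eq ⟩
  (b + l * q) % q ≡⟨ [m+kn]%n≡m%n b l q ⟩
  b % q           ∎
  where open ≡-Reasoning

b2n≤1 : ∀ b → b2n b ≤ 1
b2n≤1 true  = s≤s z≤n
b2n≤1 false = z≤n

b2n-injective : ∀ {u v} → b2n u ≡ b2n v → u ≡ v
b2n-injective {true}  {true}  _ = refl
b2n-injective {false} {false} _ = refl

represented-values-agree : ∀ {q n} {c c' : MLPoly q n} {f g : BoolFun n} → 2 ≤ q →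
  Represents {q} c f → Represents {q} c' g → ∀ {x y} → evalPoly c x ≡ evalPoly c' y → f x ≡ g y
represented-values-agree {q@(suc (suc _))} {c = c} {c'} {f} {g} (s≤s (s≤s _)) rep rep' {x} {y} eq = b2n-injective (begin
  b2n (f x)         ≡⟨ m<n⇒m%n≡m (bit<q (f x)) ⟨
  b2n (f x) % q     ≡⟨ ≡[mod]⇒%≡ (rep x) ⟨
  evalPoly c x % q  ≡⟨ cong (_% q) eq ⟩
  evalPoly c' y % q ≡⟨ ≡[mod]⇒%≡ (rep' y) ⟩
  b2n (g y) % q     ≡⟨ m<n⇒m%n≡m (bit<q (g y)) ⟩
  b2n (g y)         ∎)
  where
  open ≡-Reasoning
  bit<q : ∀ b → b2n b < q
  bit<q b = s≤s (≤-trans (b2n≤1 b) (s≤s z≤n))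

degree0⇒constant : ∀ {q n} {f : BoolFun n} → 2 ≤ q → HasDeg q f 0 → ∀ x y → f x ≡ f y
degree0⇒constant q≥2 (c , rep , deg≡0) x y =
  represented-values-agree {c = c} {c' = c} q≥2 rep rep (totalDegree≡0⇒evalPoly-constant c deg≡0 x y)

nonSymmetric⇒degree-positive : ∀ {q n d} {f : BoolFun n} → 2 ≤ q → ¬ Symmetric f → HasDeg q f d → 1 ≤ d
nonSymmetric⇒degree-positive {d = zero}  q≥2 asym deg = contradiction (λ x y _ → degree0⇒constant q≥2 deg x y) asym
nonSymmetric⇒degree-positive {d = suc _} _ _ _ = s≤s z≤n

module _ {A B : Set} {_#_ : A → A → Set} {_#′_ : B → B → Set} (F : A → A → B)
         (apartˡ : ∀ {g g' h h'} → g # g' → F g h #′ F g' h')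
         (apartʳ : ∀ {g h h'} → h # h' → F g h #′ F g h') where

  AllPairs-concatMap-map : ∀ {G H} → AllPairs _#_ G → AllPairs _#_ H →
    AllPairs _#′_ (concatMap (λ g → map (F g) H) G)
  AllPairs-concatMap-map [] _ = []
  AllPairs-concatMap-map {g ∷ G} {H} (g#G ∷ #G) #H =
    AllPairs.++⁺ (AllPairs.map⁺ (AllPairs.map apartʳ #H)) (AllPairs-concatMap-map #G #H)
      (All.map⁺ (All.universal across H))
    where
    across : ∀ h → All (F g h #′_) (concatMap (λ g' → map (F g') H) G)
    across h = All.concat⁺ (All.map⁺ (All.map (λ g#g' → All.map⁺ (All.universal (λ _ → apartˡ g#g') H)) g#G))

_≉_ : ∀ {n} → BoolFun n → BoolFun n → Set
f ≉ g = ¬ (f ≗ g)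

allFuns-distinct : ∀ n → AllPairs _≉_ (allFuns n)
allFuns-distinct zero = ((λ f≗g → false≢true (f≗g [])) ∷ []) ∷ [] ∷ []
  where
  false≢true : false ≢ true
  false≢true ()
-- The branching function of allFuns is an anonymous pattern lambda, found here by unification.
allFuns-distinct (suc n) =
  AllPairs-concatMap-map _ (λ g≉g' e → g≉g' (e ∘ (true ∷_))) (λ h≉h' e → h≉h' (e ∘ (false ∷_)))
    (allFuns-distinct n) (allFuns-distinct n)

length-allFuns : ∀ n → length (allFuns n) ≡ 2 ^ 2 ^ n
length-allFuns zero    = refl
length-allFuns (suc n) = begin
  length (allFuns (suc n))                ≡⟨ length-concatMap-const _ (λ g → length-map _ (allFuns n)) (allFuns n) ⟩
  length (allFuns n) * length (allFuns n) ≡⟨ cong₂ _*_ (length-allFuns n) (length-allFuns n) ⟩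
  2 ^ 2 ^ n * 2 ^ 2 ^ n                   ≡⟨ ^-distribˡ-+-* 2 (2 ^ n) (2 ^ n) ⟨
  2 ^ (2 ^ n + 2 ^ n)                     ≡⟨ cong (λ m → 2 ^ (2 ^ n + m)) (+-identityʳ (2 ^ n)) ⟨
  2 ^ 2 ^ suc n                           ∎
  where open ≡-Reasoning

prefixOnes : (n j : ℕ) → Vec Bool n
prefixOnes zero    _       = []
prefixOnes (suc n) zero    = false ∷ prefixOnes n zero
prefixOnes (suc n) (suc j) = true ∷ prefixOnes n j

weight-prefixOnes : ∀ {n j} → j ≤ n → weight (prefixOnes n j) ≡ j
weight-prefixOnes {zero}  z≤n       = refl
weight-prefixOnes {suc n} z≤n       = weight-prefixOnes {n} z≤n
weight-prefixOnes {suc n} (s≤s j≤n) = cong suc (weight-prefixOnes j≤n)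

weight≤length : ∀ {n} (x : Vec Bool n) → weight x ≤ n
weight≤length []          = z≤n
weight≤length (false ∷ x) = m≤n⇒m≤1+n (weight≤length x)
weight≤length (true ∷ x)  = s≤s (weight≤length x)

weightProfile : ∀ {n} → BoolFun n → List Bool
weightProfile {n} f = map (f ∘ prefixOnes n) (upTo (suc n))

SymmetricWithProfile : ∀ {n} → BoolFun n → List Bool → Set
SymmetricWithProfile f w = Symmetric f × weightProfile f ≡ w

symmetric-determined-by-profile : ∀ {n} {f g : BoolFun n} {w} →
  SymmetricWithProfile f w → SymmetricWithProfile g w → f ≗ g
symmetric-determined-by-profile {n} {f} {g} (sym-f , refl) (sym-g , eq) x = begin
  f x       ≡⟨ sym-f x x′ (sym weight-x′) ⟩
  f x′      ≡⟨ map-≡⇒≡-on-∈ (sym eq) (∈-upTo⁺ (s≤s (weight≤length x))) ⟩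
  g x′      ≡⟨ sym-g x x′ (sym weight-x′) ⟨
  g x       ∎
  where
  open ≡-Reasoning
  x′ = prefixOnes n (weight x)
  weight-x′ : weight x′ ≡ weight x
  weight-x′ = weight-prefixOnes (weight≤length x)

bits : List Bool
bits = false ∷ true ∷ []

∈-bits : ∀ b → b ∈ bits
∈-bits false = here refl
∈-bits true  = there (here refl)

profile∈words : ∀ {n} (f : BoolFun n) → weightProfile f ∈ words bits (suc n)
profile∈words {n} f = subst (λ s → weightProfile f ∈ words bits s) length-profile
  (∈-words (All.map⁺ (All.universal (λ _ → ∈-bits _) (upTo (suc n)))))
  where
  length-profile : length (weightProfile f) ≡ suc n
  length-profile = trans (length-map _ (upTo (suc n))) (length-upTo (suc n))

symmetric-count : ∀ {n} {fs : List (BoolFun n)} → AllPairs _≉_ fs → All (¬_ ∘ ¬_ ∘ Symmetric) fs →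
  length fs ≤ 2 ^ suc n
symmetric-count {n} {fs} #fs ¬¬sym = subst (length fs ≤_) (length-words bits (suc n))
  (¬¬-codes⇒length≤ _≉_ SymmetricWithProfile (λ p p′ f≉g → f≉g (symmetric-determined-by-profile p p′))
    (words bits (suc n)) #fs (All.map (¬¬-map profile-code) ¬¬sym))
  where
  profile-code : ∀ {f : BoolFun n} → Symmetric f → HasCodeIn SymmetricWithProfile (words bits (suc n)) f
  profile-code {f} sym-f = weightProfile f , profile∈words f , sym-f , refl

lightInputs : (n D : ℕ) → List (Vec Bool n)
lightInputs zero    D       = [] ∷ []
lightInputs (suc n) zero    = map (false ∷_) (lightInputs n zero)
lightInputs (suc n) (suc D) = map (false ∷_) (lightInputs n (suc D)) ++ map (true ∷_) (lightInputs n D)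

∈-lightInputs : ∀ {n D} (S : Vec Bool n) → weight S ≤ D → S ∈ lightInputs n D
∈-lightInputs             []          _         = here refl
∈-lightInputs {D = zero}  (false ∷ S) w≤D       = ∈-map⁺ (false ∷_) (∈-lightInputs S w≤D)
∈-lightInputs {D = suc D} (false ∷ S) w≤D       = ∈-++⁺ˡ (∈-map⁺ (false ∷_) (∈-lightInputs S w≤D))
∈-lightInputs {D = suc D} (true ∷ S)  (s≤s w≤D) = ∈-++⁺ʳ _ (∈-map⁺ (true ∷_) (∈-lightInputs S w≤D))

length-lightInputs : ∀ n D → length (lightInputs n D) ≤ suc n ^ D
length-lightInputs zero    D       = ≤-reflexive (sym (^-zeroˡ D))
length-lightInputs (suc n) zero    =
  ≤-trans (≤-reflexive (length-map (false ∷_) (lightInputs n zero))) (length-lightInputs n zero)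
length-lightInputs (suc n) (suc D) = begin
  length (map (false ∷_) (lightInputs n (suc D)) ++ map (true ∷_) (lightInputs n D))
    ≡⟨ length-++ (map (false ∷_) (lightInputs n (suc D))) ⟩
  length (map (false ∷_) (lightInputs n (suc D))) + length (map (true ∷_) (lightInputs n D))
    ≡⟨ cong₂ _+_ (length-map (false ∷_) (lightInputs n (suc D))) (length-map (true ∷_) (lightInputs n D)) ⟩
  length (lightInputs n (suc D)) + length (lightInputs n D)
    ≤⟨ +-mono-≤ (length-lightInputs n (suc D)) (length-lightInputs n D) ⟩
  suc n ^ suc D + suc n ^ D       ≡⟨ +-comm (suc n ^ suc D) (suc n ^ D) ⟩
  suc (suc n) * suc n ^ D         ≤⟨ *-monoʳ-≤ (suc (suc n)) (^-monoˡ-≤ D (n≤1+n (suc n))) ⟩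
  suc (suc n) ^ suc D             ∎
  where open ≤-Reasoning

LowDegree : (q D : ℕ) {n : ℕ} → BoolFun n → Set
LowDegree q D {n} f = ∃[ c ] (Represents {q} {n} c f × totalDegree c ≤ D)

module _ {q n D : ℕ} where

  LowDegreeWithCoefficients : BoolFun n → List (Fin q) → Set
  LowDegreeWithCoefficients f w = ∃[ c ] (Represents {q} c f × totalDegree c ≤ D × map c (lightInputs n D) ≡ w)

  vanishes-above-degree : ∀ (c : MLPoly q n) {S} → totalDegree c ≤ D → S ∈ inputs n → D < weight S → toℕ (c S) ≡ 0
  vanishes-above-degree c deg≤D S∈ D<w = decidable-stable (toℕ (c _) ≟ 0)
    (λ c[S]≢0 → <⇒≱ D<w (≤-trans (weight≤totalDegree c S∈ c[S]≢0) deg≤D))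

  low-coefficients-determine : ∀ {f g : BoolFun n} {w} → 2 ≤ q →
    LowDegreeWithCoefficients f w → LowDegreeWithCoefficients g w → f ≗ g
  low-coefficients-determine q≥2 (c , rep , deg≤D , refl) (c′ , rep′ , deg′≤D , eq) x =
    represented-values-agree {c = c} {c′} q≥2 rep rep′ (evalPoly-cong same-coefficients x)
    where
    same-coefficients : ∀ {S} → S ∈ inputs n → c S ≡ c′ S
    same-coefficients {S} S∈ with weight S ≤? D
    ... | yes w≤D = map-≡⇒≡-on-∈ (sym eq) (∈-lightInputs S w≤D)
    ... | no w≰D  = toℕ-injective
      (trans (vanishes-above-degree c deg≤D S∈ (≰⇒> w≰D)) (sym (vanishes-above-degree c′ deg′≤D S∈ (≰⇒> w≰D))))

  lowDegree-count : ∀ {fs : List (BoolFun n)} → 2 ≤ q → AllPairs _≉_ fs →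
    All (¬_ ∘ ¬_ ∘ LowDegree q D) fs → length fs ≤ q ^ length (lightInputs n D)
  lowDegree-count {fs} q≥2 #fs ¬¬low = subst (length fs ≤_) length-codes
    (¬¬-codes⇒length≤ _≉_ LowDegreeWithCoefficients (λ p p′ f≉g → f≉g (low-coefficients-determine q≥2 p p′))
      codes #fs (All.map (¬¬-map coefficient-code) ¬¬low))
    where
    codes = words (allFin q) (length (lightInputs n D))
    length-codes : length codes ≡ q ^ length (lightInputs n D)
    length-codes = trans (length-words (allFin q) (length (lightInputs n D))) (cong (_^ length (lightInputs n D)) (length-tabulate {n = q} (λ i → i)))
    coefficient-code : ∀ {f} → LowDegree q D f → HasCodeIn LowDegreeWithCoefficients codes f
    coefficient-code (c , rep , deg≤D) =
      map c (lightInputs n D) ,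
      subst (λ s → map c (lightInputs n D) ∈ words (allFin q) s) (length-map c (lightInputs n D))
        (∈-words (All.map⁺ (All.universal (λ S → ∈-allFin (c S)) (lightInputs n D)))) ,
      c , rep , deg≤D , refl

few-bad-functions : ∀ {n L q a b} k (Good : BoolFun n → Set) → 2 ≤ q → k + q + 6 ≤ L →
  2 ^ L ≤ suc n → suc n < 2 ^ suc L →
  (∀ {f} → ¬ Symmetric f → ¬ Good f → ¬ ¬ LowDegree q L f) →
  Count (λ f → ¬ Symmetric f) (allFuns n) a →
  Count (λ f → ¬ Symmetric f × Good f) (allFuns n) b →
  k * (a ∸ b) ≤ a
few-bad-functions {n} {L} {q} {a} {b} k Good q≥2 k+q+6≤L 2^L≤1+n 1+n<2^[1+L] bad⇒lowDegree #asym #good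
  with zs , zs⊆ , sym-zs , a+|zs|≡ ← Count⇒complement #asym
     | ys , ys⊆ , bad-ys , a≤b+|ys| ← Count-difference #asym #good = begin
  k * (a ∸ b) ≤⟨ *-monoʳ-≤ k (≤-trans (m≤n+o⇒m∸n≤o a b a≤b+|ys|) |ys|≤q^s) ⟩
  k * q ^ s   ≤⟨ +-cancelʳ-≤ (2 ^ suc n) (k * q ^ s) a k*q^s+2^[1+n]≤a+2^[1+n] ⟩
  a           ∎
  where
  open ≤-Reasoning
  s = length (lightInputs n L)
  |ys|≤q^s : length ys ≤ q ^ s
  |ys|≤q^s = lowDegree-count q≥2 (AllPairs-resp-⊆ ys⊆ (allFuns-distinct n))
    (All.map (λ (asym , bad) → bad⇒lowDegree asym bad) bad-ys)
  k*q^s+2^[1+n]≤a+2^[1+n] : k * q ^ s + 2 ^ suc n ≤ a + 2 ^ suc n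
  k*q^s+2^[1+n]≤a+2^[1+n] = begin
    k * q ^ s + 2 ^ suc n ≤⟨ counting-inequality k q n L s q≥2 k+q+6≤L 2^L≤1+n 1+n<2^[1+L] (length-lightInputs n L) ⟩
    2 ^ 2 ^ n             ≡⟨ trans (sym (length-allFuns n)) (sym a+|zs|≡) ⟩
    a + length zs         ≤⟨ +-monoʳ-≤ a (symmetric-count (AllPairs-resp-⊆ zs⊆ (allFuns-distinct n)) sym-zs) ⟩
    a + 2 ^ suc n         ∎

prodFin-positive : ∀ r {d : Fin r → ℕ} → (∀ i → 1 ≤ d i) → 1 ≤ prodFin r d
prodFin-positive zero    _   = s≤s z≤n
prodFin-positive (suc r) d≥1 = *-mono-≤ (d≥1 Fin.zero) (prodFin-positive r (d≥1 ∘ Fin.suc))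

factor≤prodFin : ∀ {r} {d : Fin r → ℕ} → (∀ i → 1 ≤ d i) → ∀ i → d i ≤ prodFin r d
factor≤prodFin {suc r} {d} d≥1 Fin.zero =
  m≤m*n (d Fin.zero) (prodFin r (d ∘ Fin.suc)) {{>-nonZero (prodFin-positive r (d≥1 ∘ Fin.suc))}}
factor≤prodFin {suc r} {d} d≥1 (Fin.suc i) =
  ≤-trans (factor≤prodFin (d≥1 ∘ Fin.suc) i) (m≤n*m _ (d Fin.zero) {{>-nonZero (d≥1 Fin.zero)}})

small-degree-product⇒lowDegree : ∀ {r n L} {q d : Fin (suc r) → ℕ} {f : BoolFun n} → (∀ i → 2 ≤ q i) →
  ¬ Symmetric f → (∀ i → HasDeg (q i) f (d i)) →
  2 ^ (prodFin (suc r) q * prodFin (suc r) d + 1) ≤ n → n < 2 ^ suc L → LowDegree (q Fin.zero) L f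
small-degree-product⇒lowDegree {r} {n} {L} {q} {d} q≥2 asym deg 2^[mD+1]≤n n<2^[1+L]
  with c , rep , deg≡ ← deg Fin.zero = c , rep , subst (_≤ L) (sym deg≡) d₀≤L
  where
  d≥1 : ∀ i → 1 ≤ d i
  d≥1 i = nonSymmetric⇒degree-positive (q≥2 i) asym (deg i)
  d₀≤mD : d Fin.zero ≤ prodFin (suc r) q * prodFin (suc r) d
  d₀≤mD = ≤-trans (factor≤prodFin d≥1 Fin.zero)
    (m≤n*m _ _ {{>-nonZero (prodFin-positive (suc r) (λ i → ≤-trans (s≤s z≤n) (q≥2 i)))}})
  d₀≤L : d Fin.zero ≤ L
  d₀≤L = ≤-trans (m≤m+n (d Fin.zero) 1) (s≤s⁻¹ (2^m<2^n⇒m<n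
    (≤-trans (s≤s (^-monoʳ-≤ 2 (+-monoˡ-≤ 1 d₀≤mD))) (≤-trans (s≤s 2^[mD+1]≤n) n<2^[1+L]))))

mainTheorem7 : (r : ℕ) → 1 ≤ r → (p e : Fin r → ℕ) →
    (∀ i → Prime (p i)) → (∀ i j → p i ≡ p j → i ≡ j) → (∀ i → 1 ≤ e i) →
    (k : ℕ) → 1 ≤ k →
    ∃[ N ] (∀ n → N ≤ n → ∀ a b →
      Count (λ (f : BoolFun n) → ¬ Symmetric f) (allFuns n) a →
      Count (λ (f : BoolFun n) → ¬ Symmetric f ×
               (∀ (d : Fin r → ℕ) → (∀ i → HasDeg (p i ^ e i) f (d i)) →
                  n < 2 ^ (prodFin r (λ i → p i ^ e i) * prodFin r d + 1)))
            (allFuns n) b →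
      k * (a ∸ b) ≤ a)
mainTheorem7 (suc r) _ p e prime _ e≥1 k _ = 2 ^ (k + q Fin.zero + 6) , bound
  where
  q : Fin (suc r) → ℕ
  q i = p i ^ e i
  q≥2 : ∀ i → 2 ≤ q i
  q≥2 i = ≤-trans (nonTrivial⇒n>1 (p i) {{prime⇒nonTrivial (prime i)}})
    (≤-trans (≤-reflexive (sym (*-identityʳ (p i)))) (^-monoʳ-≤ (p i) {{prime⇒nonZero (prime i)}} (e≥1 i)))
  Good : ∀ n → BoolFun n → Set
  Good n f = ∀ d → (∀ i → HasDeg (q i) f (d i)) → n < 2 ^ (prodFin (suc r) q * prodFin (suc r) d + 1)
  bound : ∀ n → 2 ^ (k + q Fin.zero + 6) ≤ n → ∀ a b →
    Count (λ f → ¬ Symmetric f) (allFuns n) a → Count (λ f → ¬ Symmetric f × Good n f) (allFuns n) b →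
    k * (a ∸ b) ≤ a
  bound n N≤n a b #asym #good with L , 2^L≤1+n , 1+n<2^[1+L] ← floorLog₂ n =
    few-bad-functions k (Good n) (q≥2 Fin.zero) k+q+6≤L 2^L≤1+n 1+n<2^[1+L] bad⇒lowDegree #asym #good
    where
    n<2^[1+L] : n < 2 ^ suc L
    n<2^[1+L] = <-trans (n<1+n n) 1+n<2^[1+L]
    k+q+6≤L : k + q Fin.zero + 6 ≤ L
    k+q+6≤L = s≤s⁻¹ (2^m<2^n⇒m<n (≤-trans (s≤s N≤n) n<2^[1+L]))
    bad⇒lowDegree : ∀ {f} → ¬ Symmetric f → ¬ Good n f → ¬ ¬ LowDegree (q Fin.zero) L f
    bad⇒lowDegree asym bad ¬low = bad λ d deg → decidable-stable (n <? _)
      (λ n≮ → ¬low (small-degree-product⇒lowDegree q≥2 asym deg (≮⇒≥ n≮) n<2^[1+L]))
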